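{- Let $k\ge 13$ be an integer, let $n=3k+3$, let $b=\lceil (k+1)/2\rceil$, and consider the vertex $u_0$ of $\mathrm{GP}(n,2k+1)$. Then: (i) $|S_1(u_0)|=3$, $|S_2(u_0)|=6$, $|S_3(u_0)|=12$, $|S_4(u_0)|=16$, $|S_5(u_0)|=14$; (ii) $|S_i(u_0)|=12$ for $6\le i\le b$; (iii) if $k$ is odd, then $|S_{b+1}(u_0)|=7$, $|S_{b+2}(u_0)|=1$, and $|S_i(u_0)|=0$ for $i>b+2$; (iv) if $k$ is even, then $|S_{b+1}(u_0)|=2$ and $|S_i(u_0)|=0$ for $i>b+1$.
   Context: For $n\ge 3$ and $k\in\{1,\dots,n-1\}\setminus\{n/2\}$, the generalized Petersen graph $\mathrm{GP}(n,k)$ has vertex set $\{u_i\mid i\in\mathbb{Z}_n\}\cup\{v_i\mid i\in\mathbb{Z}_n\}$ and edges $u_iu_{i+1}$, $v_iv_{i+k}$, $u_iv_i$ for $i\in\mathbb{Z}_n$. For a vertex $u$ and integer $i$, $S_i(u)$ is the set of vertices at path-length distance exactly $i$ from $u$. -}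

module Defs where

open import Data.Nat using (ℕ; zero; suc; _+_; _*_; _<_; NonZero)
open import Data.Nat.DivMod using (_mod_)
open import Data.Fin using (Fin; toℕ)
open import Data.Product using (_×_; Σ)
open import Data.Sum using (_⊎_)
open import Data.List using (List; length)
open import Data.List.Membership.Propositional using (_∈_)
open import Data.List.Relation.Unary.Unique.Propositional using (Unique)
open import Relation.Binary.PropositionalEquality using (_≡_)
open import Relation.Nullary using (¬_)
open import Function.Bundles using (_⇔_)

data Vertex (n : ℕ) : Set where
  u : Fin n → Vertex n
  v : Fin n → Vertex n

_⊕_ : ∀ {n} .{{_ : NonZero n}} → Fin n → ℕ → Fin n
_⊕_ {n} i j = (toℕ i + j) mod n

data Edge (n k : ℕ) .{{_ : NonZero n}} : Vertex n → Vertex n → Set where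
  outer : ∀ i → Edge n k (u i) (u (i ⊕ 1))
  inner : ∀ i → Edge n k (v i) (v (i ⊕ k))
  spoke : ∀ i → Edge n k (u i) (v i)

Adj : (n k : ℕ) .{{_ : NonZero n}} → Vertex n → Vertex n → Set
Adj n k x y = Edge n k x y ⊎ Edge n k y x

data Walk (n k : ℕ) .{{_ : NonZero n}} : Vertex n → Vertex n → ℕ → Set where
  [] : ∀ {x} → Walk n k x x zero
  _∷_ : ∀ {x y z ℓ} → Adj n k x y → Walk n k y z ℓ → Walk n k x z (suc ℓ)

IsDist : (n k : ℕ) .{{_ : NonZero n}} → Vertex n → Vertex n → ℕ → Set
IsDist n k x y i = Σ (Walk n k x y i) (λ _ → ∀ j → j < i → ¬ Walk n k x y j)

SphereCard : (n k : ℕ) .{{_ : NonZero n}} → Vertex n → ℕ → ℕ → Set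
SphereCard n k x i m =
  Σ (List (Vertex n)) λ ws →
    Unique ws × ((∀ y → (y ∈ ws) ⇔ IsDist n k x y i) × length ws ≡ m)

{-# OPTIONS --safe #-}
module Submission where

-- Write a vertex of GP(3k+3, 2k+1) as u or v at index (k+1)·t + a with block t ∈ {0,1,2} and
-- offset a ≤ k.  Outer edges raise the offset by one, while inner edges, a jump by
-- 2k+1 ≡ −(k+2), lower it by one and change the block.  The distance from u₀ is
-- min(F κ a, G κ (k − a)) for two explicit profiles per kind κ = (side, block): the formula
-- changes by at most one along every edge, and every vertex other than u₀ has a neighbour on
-- which it drops by one.  Both profiles are linear, f + a and g + r, from value 6 on, so a
-- sphere of radius i ≥ 6 meets a kind in the offsets where min(f + a, g + (k − a)) = i: two
-- while 2i < k + f + g, one at equality, none beyond; f + g = 5 for the outer vertices of the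
-- middle block and 3 for the other five kinds.  Spheres of radius at most 5 only see offsets
-- within 5 of either end of the block, where the profiles are read off directly.

open import Defs
open import Data.Nat
open import Data.Nat.Properties
open import Data.Nat.DivMod using (_mod_; m%n<n; %-distribˡ-+; m%n%n≡m%n; [m+n]%n≡m%n; m<n⇒m%n≡m)
open import Data.Nat.ListAction using (sum)
open import Data.Nat.Solver using (module +-*-Solver)
open +-*-Solver using (solve; _:+_; _:*_; _:=_; con)
open import Data.Bool using (true; false; T)
open import Data.Fin using (Fin; zero; toℕ)
open import Data.Fin.Properties using (toℕ-injective; toℕ-fromℕ<; toℕ<n)
open import Data.Product using (_×_; _,_; proj₁; proj₂; ∃-syntax)
import Data.Product
open import Data.Sum using (_⊎_; inj₁; inj₂)
import Data.Sum
open import Data.List using (List; []; _∷_; _++_; map; filter; length; upTo; cartesianProduct)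
open import Data.List.Properties using (length-++; length-map; filter-++; map-cong)
open import Data.List.Membership.Propositional using (_∈_; _∉_)
open import Data.List.Membership.Propositional.Properties
  using (∈-filter⁺; ∈-filter⁻; ∈-map⁺; ∈-map⁻; ∈-++⁺ˡ; ∈-++⁺ʳ; ∈-++⁻; ∈-upTo⁺; ∈-upTo⁻; ∈-cartesianProduct⁺; ∈-cartesianProduct⁻)
open import Data.List.Membership.Propositional.Properties.WithK using (unique∧set⇒bag)
open import Data.List.Relation.Unary.Any using (here; there)
open import Data.List.Relation.Unary.All as All using (All)
import Data.List.Relation.Unary.All.Properties as All
open import Data.List.Relation.Unary.AllPairs using ([]; _∷_)
open import Data.List.Relation.Unary.Unique.Propositional using (Unique)
import Data.List.Relation.Unary.Unique.Propositional.Properties as Unique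
open import Data.List.Relation.Binary.BagAndSetEquality using (∼bag⇒↭)
open import Data.List.Relation.Binary.Permutation.Propositional.Properties using (↭-length)
open import Function using (_∘_; id; _⇔_; mk⇔; Equivalence)
open import Function.Properties.Equivalence using () renaming (trans to ⇔-trans; sym to ⇔-sym)
open import Level using (Level)
open import Relation.Nullary using (Dec; yes; no; does; contradiction)
open import Relation.Unary using (Pred; Decidable)
open import Relation.Binary.PropositionalEquality

module _ {ℓ : Level} {A : Set ℓ} where

  unique∧set⇒length≡ : {xs ys : List A} → Unique xs → Unique ys →
                       (∀ {z} → z ∈ xs ⇔ z ∈ ys) → length xs ≡ length ys
  unique∧set⇒length≡ uxs uys xs≈ys = ↭-length (∼bag⇒↭ (unique∧set⇒bag uxs uys xs≈ys))

module _ {ℓ ℓ′ ℓₚ : Level} {A : Set ℓ} {B : Set ℓ′} {P : Pred B ℓₚ} (P? : Decidable P) where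

  length-filter-map : ∀ (f : A → B) xs → length (filter P? (map f xs)) ≡ length (filter (P? ∘ f) xs)
  length-filter-map f [] = refl
  length-filter-map f (x ∷ xs) with does (P? (f x))
  ... | true  = cong suc (length-filter-map f xs)
  ... | false = length-filter-map f xs

module _ {ℓ ℓ′ ℓₚ : Level} {A : Set ℓ} {B : Set ℓ′} {P : Pred (A × B) ℓₚ} (P? : Decidable P) where

  length-filter-cartesianProduct : ∀ xs ys →
    length (filter P? (cartesianProduct xs ys)) ≡ sum (map (λ x → length (filter (P? ∘ (x ,_)) ys)) xs)
  length-filter-cartesianProduct [] ys = refl
  length-filter-cartesianProduct (x ∷ xs) ys = begin
    length (filter P? (map (x ,_) ys ++ cartesianProduct xs ys))
      ≡⟨ cong length (filter-++ P? (map (x ,_) ys) (cartesianProduct xs ys)) ⟩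
    length (filter P? (map (x ,_) ys) ++ filter P? (cartesianProduct xs ys))
      ≡⟨ length-++ (filter P? (map (x ,_) ys)) ⟩
    length (filter P? (map (x ,_) ys)) + length (filter P? (cartesianProduct xs ys))
      ≡⟨ cong₂ _+_ (length-filter-map P? (x ,_) ys) (length-filter-cartesianProduct xs ys) ⟩
    length (filter (P? ∘ (x ,_)) ys) + sum (map (λ x → length (filter (P? ∘ (x ,_)) ys)) xs)
      ∎
    where open ≡-Reasoning

⊓≡⇔ : ∀ {m n i} → m ⊓ n ≡ i ⇔ (i + i ≤ m + n × (m ≡ i ⊎ n ≡ i))
⊓≡⇔ {m} {n} {i} = mk⇔ to from
  where
  to : m ⊓ n ≡ i → i + i ≤ m + n × (m ≡ i ⊎ n ≡ i)
  to refl = +-mono-≤ (m⊓n≤m m n) (m⊓n≤n m n) , Data.Sum.map sym sym (⊓-sel m n)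
  from : i + i ≤ m + n × (m ≡ i ⊎ n ≡ i) → m ⊓ n ≡ i
  from (2i≤ , inj₁ refl) = m≤n⇒m⊓n≡m (+-cancelˡ-≤ m m n 2i≤)
  from (2i≤ , inj₂ refl) = m≥n⇒m⊓n≡n (+-cancelʳ-≤ n n m 2i≤)

module _ {ℓ ℓ′ : Level} {A : Set ℓ} {B : Set ℓ′} {f : A → B} where

  map⁺-injectiveOn : ∀ {xs} → (∀ {x y} → x ∈ xs → y ∈ xs → f x ≡ f y → x ≡ y) →
                     Unique xs → Unique (map f xs)
  map⁺-injectiveOn inj [] = []
  map⁺-injectiveOn inj (x∉xs ∷ uxs) =
    All.map⁺ (All.tabulate (λ y∈xs fx≡fy → All.lookup x∉xs y∈xs (inj (here refl) (there y∈xs) fx≡fy)))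
    ∷ map⁺-injectiveOn (λ x∈ y∈ → inj (there x∈) (there y∈)) uxs

-- For numerals the implicit argument has type ⊤ and is filled in by Agda.
≤-eval : ∀ {m n} {_ : T (m ≤ᵇ n)} → m ≤ n
≤-eval {m} {n} {m≤ᵇn} = ≤ᵇ⇒≤ m n m≤ᵇn

-- The threshold 6 is the value from which the distance profiles of GP(3k+3, 2k+1) are linear.
record Ramp (h : ℕ → ℕ) (start : ℕ) : Set where
  field
    offset         : ℕ
    offset+start≤6 : offset + start ≤ 6
    initial        : ∀ a → a < start → h a ≤ 5
    linear         : ∀ a → h (start + a) ≡ offset + (start + a)

module _ {h : ℕ → ℕ} {start : ℕ} (r : Ramp h start) where
  open Ramp r

  start≤⇒linear : ∀ {a} → start ≤ a → h a ≡ offset + a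
  start≤⇒linear {a} s≤a = begin
    h a                            ≡⟨ cong h (sym (m+[n∸m]≡n s≤a)) ⟩
    h (start + (a ∸ start))        ≡⟨ linear (a ∸ start) ⟩
    offset + (start + (a ∸ start)) ≡⟨ cong (offset +_) (m+[n∸m]≡n s≤a) ⟩
    offset + a                     ∎
    where open ≡-Reasoning

  large-line⇒linear : ∀ {a} → 6 ≤ offset + a → h a ≡ offset + a
  large-line⇒linear 6≤ = start≤⇒linear (+-cancelˡ-≤ offset _ _ (≤-trans offset+start≤6 6≤))

  large-value⇒linear : ∀ {a} → 6 ≤ h a → h a ≡ offset + a
  large-value⇒linear {a} 6≤ with a <? start
  ... | yes a<s = contradiction (initial a a<s) (<⇒≱ 6≤)
  ... | no  a≮s = start≤⇒linear (≮⇒≥ a≮s)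

  large-argument⇒large-value : ∀ {a} → 6 ≤ a → 6 ≤ h a
  large-argument⇒large-value {a} 6≤a = begin
    6          ≤⟨ ≤-trans 6≤a (m≤n+m a offset) ⟩
    offset + a ≡⟨ large-line⇒linear (≤-trans 6≤a (m≤n+m a offset)) ⟨
    h a        ∎
    where open ≤-Reasoning

  small-value⇒small-argument : ∀ {a} → h a ≤ 5 → a ≤ 5
  small-value⇒small-argument {a} h≤5 with 6 ≤? a
  ... | yes 6≤a = contradiction (large-argument⇒large-value 6≤a) (<⇒≱ (s≤s h≤5))
  ... | no  6≰a = ≤-pred (≰⇒> 6≰a)

-- With s = k + f + g and f, g ≤ i, m counts the offsets a ≤ k with (f + a) ⊓ (g + (k ∸ a)) ≡ i.
data Crossing (s i : ℕ) : ℕ → Set where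
  below : i + i < s → Crossing s i 2
  at    : i + i ≡ s → Crossing s i 1
  above : s < i + i → Crossing s i 0

earlyHits : (ℕ → ℕ) → ℕ → List ℕ
earlyHits h i = filter (λ a → h a ≟ i) (upTo 6)

∈-earlyHits : ∀ h {a i} → a ∈ earlyHits h i ⇔ (a < 6 × h a ≡ i)
∈-earlyHits h {i = i} = mk⇔ (Data.Product.map₁ ∈-upTo⁻ ∘ ∈-filter⁻ (λ a → h a ≟ i))
                              (λ (a<6 , ha≡i) → ∈-filter⁺ (λ a → h a ≟ i) (∈-upTo⁺ a<6) ha≡i)

earlyHits-unique : ∀ h i → Unique (earlyHits h i)
earlyHits-unique h i = Unique.filter⁺ (λ a → h a ≟ i) (Unique.upTo⁺ 6)

module Profile (k : ℕ) {F G : ℕ → ℕ} {s t : ℕ} (rF : Ramp F s) (rG : Ramp G t) where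

  D : ℕ → ℕ
  D a = F a ⊓ G (k ∸ a)

  D≟ : ∀ i a → Dec (D a ≡ i)
  D≟ i a = D a ≟ i

  hits : ℕ → List ℕ
  hits i = filter (D≟ i) (upTo (suc k))

  ∈-hits : ∀ {a i} → a ∈ hits i ⇔ (a ≤ k × D a ≡ i)
  ∈-hits {i = i} = mk⇔ (λ a∈ → Data.Product.map (≤-pred ∘ ∈-upTo⁻) id (∈-filter⁻ (D≟ i) a∈))
                       (λ (a≤k , Da≡i) → ∈-filter⁺ (D≟ i) (∈-upTo⁺ (s≤s a≤k)) Da≡i)

  hits-unique : ∀ i → Unique (hits i)
  hits-unique i = Unique.filter⁺ (D≟ i) (Unique.upTo⁺ (suc k))

  length-hits : ∀ {i} (xs : List ℕ) → Unique xs → (∀ {a} → a ∈ xs ⇔ (a ≤ k × D a ≡ i)) →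
                length (hits i) ≡ length xs
  length-hits {i} xs uxs ∈xs = unique∧set⇒length≡ (hits-unique i) uxs
    (⇔-trans ∈-hits (⇔-sym ∈xs))

  module _ (11≤k : 11 ≤ k) {i : ℕ} (i≤5 : i ≤ 5) where

    private
      far-from : ∀ {a} → a < 6 → 6 ≤ k ∸ a
      far-from {a} a<6 = ∸-mono {11} {k} {5} {a} 11≤k (≤-pred a<6)

      early≤k : ∀ {a} → a < 6 → a ≤ k
      early≤k a<6 = ≤-trans (<⇒≤ a<6) (≤-trans (m≤n+m 6 5) 11≤k)

      i≤large : ∀ {m} → 6 ≤ m → i ≤ m
      i≤large 6≤m = ≤-trans i≤5 (≤-trans (n≤1+n 5) 6≤m)

      hit-near-0 : ∀ {a} → a < 6 → F a ≡ i → D a ≡ i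
      hit-near-0 a<6 refl = m≤n⇒m⊓n≡m (i≤large (large-argument⇒large-value rG (far-from a<6)))

      hit-near-k : ∀ {r} → r < 6 → G r ≡ i → D (k ∸ r) ≡ i
      hit-near-k {r} r<6 refl = begin
        F (k ∸ r) ⊓ G (k ∸ (k ∸ r)) ≡⟨ cong (λ x → F (k ∸ r) ⊓ G x) (m∸[m∸n]≡n (early≤k r<6)) ⟩
        F (k ∸ r) ⊓ G r             ≡⟨ m≥n⇒m⊓n≡n (i≤large (large-argument⇒large-value rF (far-from r<6))) ⟩
        G r                         ∎
        where open ≡-Reasoning

      near-0-or-k : ∀ {a} → D a ≡ i → (a < 6 × F a ≡ i) ⊎ (k ∸ a < 6 × G (k ∸ a) ≡ i)
      near-0-or-k {a} refl with ⊓-sel (F a) (G (k ∸ a))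
      ... | inj₁ D≡F = inj₁ (s≤s (small-value⇒small-argument rF (subst (_≤ 5) D≡F i≤5)) , sym D≡F)
      ... | inj₂ D≡G = inj₂ (s≤s (small-value⇒small-argument rG (subst (_≤ 5) D≡G i≤5)) , sym D≡G)

      nearHits : List ℕ
      nearHits = earlyHits F i ++ map (k ∸_) (earlyHits G i)

      nearHits-unique : Unique nearHits
      nearHits-unique = Unique.++⁺ (earlyHits-unique F i)
        (map⁺-injectiveOn (λ r∈ r′∈ → ∸-cancelˡ-≡ (early≤ r∈) (early≤ r′∈)) (earlyHits-unique G i))
        (λ (a∈ , a∈′) → disjoint a∈ a∈′)
        where
        early≤ : ∀ {r} → r ∈ earlyHits G i → r ≤ k
        early≤ = early≤k ∘ proj₁ ∘ Equivalence.to (∈-earlyHits G)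
        disjoint : ∀ {a} → a ∈ earlyHits F i → a ∉ map (k ∸_) (earlyHits G i)
        disjoint a∈ a∈′ with ∈-map⁻ (k ∸_) a∈′
        ... | r , r∈ , refl = <⇒≱ (proj₁ (Equivalence.to (∈-earlyHits F) a∈))
                                  (far-from (proj₁ (Equivalence.to (∈-earlyHits G) r∈)))

      ∈-nearHits : ∀ {a} → a ∈ nearHits ⇔ (a ≤ k × D a ≡ i)
      ∈-nearHits {a} = mk⇔ to from
        where
        to : a ∈ nearHits → a ≤ k × D a ≡ i
        to a∈ with ∈-++⁻ (earlyHits F i) a∈
        ... | inj₁ a∈F = let a<6 , Fa≡i = Equivalence.to (∈-earlyHits F) a∈F in early≤k a<6 , hit-near-0 a<6 Fa≡i
        ... | inj₂ a∈G with ∈-map⁻ (k ∸_) a∈G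
        ...   | r , r∈G , refl = let r<6 , Gr≡i = Equivalence.to (∈-earlyHits G) r∈G in m∸n≤m k r , hit-near-k r<6 Gr≡i
        from : a ≤ k × D a ≡ i → a ∈ nearHits
        from (a≤k , Da≡i) with near-0-or-k Da≡i
        ... | inj₁ early = ∈-++⁺ˡ (Equivalence.from (∈-earlyHits F) early)
        ... | inj₂ late  = ∈-++⁺ʳ (earlyHits F i) (subst (_∈ map (k ∸_) (earlyHits G i)) (m∸[m∸n]≡n a≤k)
                             (∈-map⁺ (k ∸_) (Equivalence.from (∈-earlyHits G) late)))

    length-hits-near : length (hits i) ≡ length (earlyHits F i) + length (earlyHits G i)
    length-hits-near = begin
      length (hits i)                                                ≡⟨ length-hits nearHits nearHits-unique ∈-nearHits ⟩
      length (earlyHits F i ++ map (k ∸_) (earlyHits G i))           ≡⟨ length-++ (earlyHits F i) ⟩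
      length (earlyHits F i) + length (map (k ∸_) (earlyHits G i))   ≡⟨ cong (length (earlyHits F i) +_) (length-map (k ∸_) (earlyHits G i)) ⟩
      length (earlyHits F i) + length (earlyHits G i)                ∎
      where open ≡-Reasoning

  module _ {i : ℕ} (6≤i : 6 ≤ i) where

    private
      f g : ℕ
      f = Ramp.offset rF
      g = Ramp.offset rG

      offset≤i : ∀ {h s} (r : Ramp h s) → Ramp.offset r ≤ i
      offset≤i r = ≤-trans (m+n≤o⇒m≤o _ (Ramp.offset+start≤6 r)) 6≤i

      D≡i⇔tent≡i : ∀ {a} → D a ≡ i ⇔ (f + a) ⊓ (g + (k ∸ a)) ≡ i
      D≡i⇔tent≡i {a} = mk⇔ to from
        where
        to : D a ≡ i → (f + a) ⊓ (g + (k ∸ a)) ≡ i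
        to Da≡i = trans (sym (cong₂ _⊓_ (large-value⇒linear rF (≤-trans 6≤i i≤F))
                                        (large-value⇒linear rG (≤-trans 6≤i i≤G)))) Da≡i
          where
          i≤F : i ≤ F a
          i≤F = subst (_≤ F a) Da≡i (m⊓n≤m _ _)
          i≤G : i ≤ G (k ∸ a)
          i≤G = subst (_≤ G (k ∸ a)) Da≡i (m⊓n≤n _ _)
        from : (f + a) ⊓ (g + (k ∸ a)) ≡ i → D a ≡ i
        from tent≡i = trans (cong₂ _⊓_ (large-line⇒linear rF (≤-trans 6≤i i≤f+a))
                                       (large-line⇒linear rG (≤-trans 6≤i i≤g+r))) tent≡i
          where
          i≤f+a : i ≤ f + a
          i≤f+a = subst (_≤ f + a) tent≡i (m⊓n≤m _ _)
          i≤g+r : i ≤ g + (k ∸ a)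
          i≤g+r = subst (_≤ g + (k ∸ a)) tent≡i (m⊓n≤n _ _)

      tent-sum : ∀ {a} → a ≤ k → (f + a) + (g + (k ∸ a)) ≡ k + (f + g)
      tent-sum {a} a≤k = begin
        (f + a) + (g + (k ∸ a)) ≡⟨ solve 4 (λ f a g r → (f :+ a) :+ (g :+ r) := (a :+ r) :+ (f :+ g)) refl f a g (k ∸ a) ⟩
        (a + (k ∸ a)) + (f + g) ≡⟨ cong (_+ (f + g)) (m+[n∸m]≡n a≤k) ⟩
        k + (f + g)             ∎
        where open ≡-Reasoning

      hit⇔ : ∀ {a} → a ≤ k → D a ≡ i ⇔ (i + i ≤ k + (f + g) × (f + a ≡ i ⊎ g + (k ∸ a) ≡ i))
      hit⇔ {a} a≤k = ⇔-trans D≡i⇔tent≡i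
        (subst (λ s → (f + a) ⊓ (g + (k ∸ a)) ≡ i ⇔ (i + i ≤ s × (f + a ≡ i ⊎ g + (k ∸ a) ≡ i))) (tent-sum a≤k) ⊓≡⇔)

      module Reached (2i≤s : i + i ≤ k + (f + g)) where

        p q : ℕ
        p = i ∸ f
        q = k ∸ (i ∸ g)

        p+[i∸g]+[f+g]≡2i : p + (i ∸ g) + (f + g) ≡ i + i
        p+[i∸g]+[f+g]≡2i = begin
          p + (i ∸ g) + (f + g)   ≡⟨ solve 4 (λ p r f g → p :+ r :+ (f :+ g) := (f :+ p) :+ (g :+ r)) refl p (i ∸ g) f g ⟩
          (f + p) + (g + (i ∸ g)) ≡⟨ cong₂ _+_ (m+[n∸m]≡n (offset≤i rF)) (m+[n∸m]≡n (offset≤i rG)) ⟩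
          i + i                   ∎
          where open ≡-Reasoning

        p+[i∸g]≤k : p + (i ∸ g) ≤ k
        p+[i∸g]≤k = +-cancelʳ-≤ (f + g) _ _ (subst (_≤ k + (f + g)) (sym p+[i∸g]+[f+g]≡2i) 2i≤s)

        p≤k : p ≤ k
        p≤k = m+n≤o⇒m≤o p p+[i∸g]≤k

        i∸g≤k : i ∸ g ≤ k
        i∸g≤k = m+n≤o⇒n≤o p p+[i∸g]≤k

        rising⇔ : ∀ {a} → f + a ≡ i ⇔ a ≡ p
        rising⇔ {a} = mk⇔ (λ { refl → sym (m+n∸m≡n f a) }) (λ { refl → m+[n∸m]≡n (offset≤i rF) })

        falling⇔ : ∀ {a} → a ≤ k → g + (k ∸ a) ≡ i ⇔ a ≡ q
        falling⇔ {a} a≤k = mk⇔ to (λ { refl → trans (cong (g +_) (m∸[m∸n]≡n i∸g≤k)) (m+[n∸m]≡n (offset≤i rG)) })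
          where
          to : g + (k ∸ a) ≡ i → a ≡ q
          to refl = trans (sym (m∸[m∸n]≡n a≤k)) (cong (k ∸_) (sym (m+n∸m≡n g (k ∸ a))))

        crossing-hit⇔ : ∀ {a} → (a ≤ k × D a ≡ i) ⇔ (a ≡ p ⊎ a ≡ q)
        crossing-hit⇔ {a} = mk⇔ to from
          where
          to : a ≤ k × D a ≡ i → a ≡ p ⊎ a ≡ q
          to (a≤k , Da≡i) = Data.Sum.map (Equivalence.to rising⇔) (Equivalence.to (falling⇔ a≤k))
                                         (proj₂ (Equivalence.to (hit⇔ a≤k) Da≡i))
          from : a ≡ p ⊎ a ≡ q → a ≤ k × D a ≡ i
          from (inj₁ refl) = p≤k , Equivalence.from (hit⇔ p≤k) (2i≤s , inj₁ (Equivalence.from rising⇔ refl))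
          from (inj₂ refl) = q≤k , Equivalence.from (hit⇔ q≤k) (2i≤s , inj₂ (Equivalence.from (falling⇔ q≤k) refl))
            where
            q≤k : q ≤ k
            q≤k = m∸n≤m k (i ∸ g)

    length-hits-far : ∀ {m} → Crossing (k + (Ramp.offset rF + Ramp.offset rG)) i m → length (hits i) ≡ m
    length-hits-far (below 2i<s) = length-hits (p ∷ q ∷ []) ((<⇒≢ p<q All.∷ All.[]) ∷ All.[] ∷ []) (⇔-sym (⇔-trans crossing-hit⇔ ∈-pair))
      where
      open Reached (<⇒≤ 2i<s)
      p<q : p < q
      p<q = m+n≤o⇒m≤o∸n (suc p) (+-cancelʳ-< (f + g) _ _ (subst (_< k + (f + g)) (sym p+[i∸g]+[f+g]≡2i) 2i<s))
      ∈-pair : ∀ {a} → (a ≡ p ⊎ a ≡ q) ⇔ a ∈ p ∷ q ∷ []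
      ∈-pair = mk⇔ (λ { (inj₁ a≡p) → here a≡p ; (inj₂ a≡q) → there (here a≡q) })
                   (λ { (here a≡p) → inj₁ a≡p ; (there (here a≡q)) → inj₂ a≡q })
    length-hits-far (at 2i≡s) = length-hits (p ∷ []) (All.[] ∷ []) (⇔-sym (⇔-trans crossing-hit⇔ ∈-single))
      where
      open Reached (≤-reflexive 2i≡s)
      q≡p : q ≡ p
      q≡p = trans (cong (_∸ (i ∸ g)) (sym p+[i∸g]≡k)) (m+n∸n≡m p (i ∸ g))
        where
        p+[i∸g]≡k : p + (i ∸ g) ≡ k
        p+[i∸g]≡k = +-cancelʳ-≡ (f + g) _ _ (trans p+[i∸g]+[f+g]≡2i 2i≡s)
      ∈-single : ∀ {a} → (a ≡ p ⊎ a ≡ q) ⇔ a ∈ p ∷ []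
      ∈-single = mk⇔ (λ { (inj₁ a≡p) → here a≡p ; (inj₂ a≡q) → here (trans a≡q q≡p) })
                     (λ { (here a≡p) → inj₁ a≡p })
    length-hits-far (above s<2i) = length-hits [] []
      (mk⇔ (λ ()) (λ (a≤k , Da≡i) → contradiction (proj₁ (Equivalence.to (hit⇔ a≤k) Da≡i)) (<⇒≱ s<2i)))

module _ {n k : ℕ} .{{_ : NonZero n}} where

  _∷ʳ_ : ∀ {x y z ℓ} → Walk n k x y ℓ → Adj n k y z → Walk n k x z (suc ℓ)
  []       ∷ʳ e = e ∷ []
  (e′ ∷ w) ∷ʳ e = e′ ∷ (w ∷ʳ e)

  record DistanceLabelling (x₀ : Vertex n) (d : Vertex n → ℕ) : Set where
    field
      root-zero : d x₀ ≡ 0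
      zero-root : ∀ {y} → d y ≡ 0 → y ≡ x₀
      adj-≤     : ∀ {x y} → Adj n k x y → d y ≤ suc (d x)
      descent   : ∀ {y m} → d y ≡ suc m → ∃[ z ] (Adj n k z y × d z ≡ m)

    label≤length : ∀ {y ℓ} → Walk n k x₀ y ℓ → d y ≤ ℓ
    label≤length {y} {ℓ} w = subst (λ d₀ → d y ≤ d₀ + ℓ) root-zero (go w)
      where
      go : ∀ {x y ℓ} → Walk n k x y ℓ → d y ≤ d x + ℓ
      go {x} [] = m≤m+n (d x) 0
      go {x} {ℓ = suc ℓ} (e ∷ w) = ≤-trans (go w) (≤-trans (+-monoˡ-≤ ℓ (adj-≤ e)) (≤-reflexive (sym (+-suc (d x) ℓ))))

    walk-of-label : ∀ {y m} → d y ≡ m → Walk n k x₀ y m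
    walk-of-label {m = zero}  dy≡0 = subst (λ y → Walk n k x₀ y 0) (sym (zero-root dy≡0)) []
    walk-of-label {m = suc m} dy≡1+m with descent dy≡1+m
    ... | z , z~y , dz≡m = walk-of-label dz≡m ∷ʳ z~y

    isDist⇔ : ∀ {y i} → IsDist n k x₀ y i ⇔ d y ≡ i
    isDist⇔ {y} {i} = mk⇔ to (λ dy≡i → walk-of-label dy≡i , λ j j<i w → <⇒≱ j<i (subst (_≤ j) dy≡i (label≤length w)))
      where
      to : IsDist n k x₀ y i → d y ≡ i
      to (w , shortest) with d y <? i
      ... | yes dy<i = contradiction (walk-of-label refl) (shortest (d y) dy<i)
      ... | no  dy≮i = ≤-antisym (label≤length w) (≮⇒≥ dy≮i)

  record Coding (C : Set) : Set where
    field
      vert         : C → Vertex n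
      code         : Vertex n → C
      codes        : List C
      codes-unique : Unique codes
      code∈codes   : ∀ y → code y ∈ codes
      vert-code    : ∀ y → vert (code y) ≡ y
      code-vert    : ∀ {c} → c ∈ codes → code (vert c) ≡ c

    sphereCard : ∀ {x} (D : C → ℕ) → (∀ {y i} → IsDist n k x y i ⇔ D (code y) ≡ i) →
                 ∀ i → SphereCard n k x i (length (filter (λ c → D c ≟ i) codes))
    sphereCard {x} D isDist⇔ i = map vert sphere , unique , ∈⇔isDist , length-map vert sphere
      where
      D≟i : ∀ c → Dec (D c ≡ i)
      D≟i c = D c ≟ i
      sphere : List C
      sphere = filter D≟i codes
      ∈codes : ∀ {c} → c ∈ sphere → c ∈ codes
      ∈codes = proj₁ ∘ ∈-filter⁻ D≟i {xs = codes}
      unique : Unique (map vert sphere)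
      unique = map⁺-injectiveOn (λ c∈ c′∈ e → trans (sym (code-vert (∈codes c∈))) (trans (cong code e) (code-vert (∈codes c′∈))))
                                (Unique.filter⁺ D≟i codes-unique)
      ∈⇔isDist : ∀ y → y ∈ map vert sphere ⇔ IsDist n k x y i
      ∈⇔isDist y = mk⇔ to from
        where
        to : y ∈ map vert sphere → IsDist n k x y i
        to y∈ with ∈-map⁻ vert y∈
        ... | c , c∈ , refl = Equivalence.from isDist⇔ (trans (cong D (code-vert (∈codes c∈))) (proj₂ (∈-filter⁻ D≟i {xs = codes} c∈)))
        from : IsDist n k x y i → y ∈ map vert sphere
        from dist = subst (_∈ map vert sphere) (vert-code y)
                      (∈-map⁺ vert (∈-filter⁺ D≟i (code∈codes y) (Equivalence.to isDist⇔ dist)))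

data Side : Set where
  U V : Side

data Block : Set where
  b₀ b₁ b₂ : Block

next : Block → Block
next b₀ = b₁
next b₁ = b₂
next b₂ = b₀

Kind : Set
Kind = Side × Block

kinds : List Kind
kinds = cartesianProduct (U ∷ V ∷ []) (b₀ ∷ b₁ ∷ b₂ ∷ [])

module Coordinates (k : ℕ) where

  n K : ℕ
  n = suc (3 * k + 2)
  K = 2 * k + 1

  base : Block → ℕ
  base b₀ = 0
  base b₁ = suc k
  base b₂ = suc k + suc k

  n≡3[1+k] : n ≡ suc k + suc k + suc k
  n≡3[1+k] = solve 1 (λ k → con 1 :+ (con 3 :* k :+ con 2) := (con 1 :+ k) :+ (con 1 :+ k) :+ (con 1 :+ k)) refl k

  idx : ℕ → Fin n
  idx x = x mod n

  idx-≡ : ∀ x y → x % n ≡ y % n → idx x ≡ idx y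
  idx-≡ x y e = toℕ-injective (trans (toℕ-fromℕ< (m%n<n x n)) (trans e (sym (toℕ-fromℕ< (m%n<n y n)))))

  idx-⊕ : ∀ x m → idx x ⊕ m ≡ idx (x + m)
  idx-⊕ x m = idx-≡ (toℕ (idx x) + m) (x + m) (begin
    (toℕ (idx x) + m) % n   ≡⟨ cong (λ r → (r + m) % n) (toℕ-fromℕ< (m%n<n x n)) ⟩
    (x % n + m) % n         ≡⟨ %-distribˡ-+ (x % n) m n ⟩
    (x % n % n + m % n) % n ≡⟨ cong (λ r → (r + m % n) % n) (m%n%n≡m%n x n) ⟩
    (x % n + m % n) % n     ≡⟨ %-distribˡ-+ x m n ⟨
    (x + m) % n             ∎)
    where open ≡-Reasoning

  idx-+n : ∀ x → idx (x + n) ≡ idx x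
  idx-+n x = idx-≡ (x + n) x ([m+n]%n≡m%n x n)

  position : Block → ℕ → Fin n
  position t a = idx (base t + a)

  base+offset<n : ∀ t {a} → a ≤ k → base t + a < n
  base+offset<n t {a} a≤k = ≤-trans (+-monoʳ-< (base t) (s≤s a≤k)) (≤-trans (base+1+k≤ t) (≤-reflexive (sym n≡3[1+k])))
    where
    base+1+k≤ : ∀ t → base t + suc k ≤ suc k + suc k + suc k
    base+1+k≤ b₀ = m≤n+m (suc k) (suc k + suc k)
    base+1+k≤ b₁ = m≤m+n (suc k + suc k) (suc k)
    base+1+k≤ b₂ = ≤-refl

  toℕ-position : ∀ t {a} → a ≤ k → toℕ (position t a) ≡ base t + a
  toℕ-position t {a} a≤k = trans (toℕ-fromℕ< (m%n<n (base t + a) n)) (m<n⇒m%n≡m (base+offset<n t a≤k))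

  blockView : ∀ x → x < n → ∃[ t ] ∃[ a ] (a ≤ k × base t + a ≡ x)
  blockView x x<n with x <? suc k
  ... | yes x<1+k = b₀ , x , ≤-pred x<1+k , refl
  ... | no  x≮1+k with x ∸ suc k <? suc k
  ...   | yes y<1+k = b₁ , x ∸ suc k , ≤-pred y<1+k , m+[n∸m]≡n (≮⇒≥ x≮1+k)
  ...   | no  y≮1+k = b₂ , x ∸ suc k ∸ suc k , ≤-pred z<1+k , x≡
    where
    x≡ : suc k + suc k + (x ∸ suc k ∸ suc k) ≡ x
    x≡ = trans (+-assoc (suc k) (suc k) _) (trans (cong (suc k +_) (m+[n∸m]≡n (≮⇒≥ y≮1+k))) (m+[n∸m]≡n (≮⇒≥ x≮1+k)))
    z<1+k : x ∸ suc k ∸ suc k < suc k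
    z<1+k = +-cancelˡ-< (suc k + suc k) _ _ (subst (_< suc k + suc k + suc k) (sym x≡) (subst (x <_) n≡3[1+k] x<n))

  no-overflow : ∀ {a b} → a ≤ k → a ≢ suc k + b
  no-overflow {a} {b} a≤k refl = <⇒≱ (s≤s a≤k) (m≤m+n (suc k) b)

  base-injective : ∀ t t′ {a a′} → a ≤ k → a′ ≤ k → base t + a ≡ base t′ + a′ → t ≡ t′ × a ≡ a′
  base-injective b₀ b₀ _ _ e = refl , e
  base-injective b₁ b₁ _ _ e = refl , +-cancelˡ-≡ (suc k) _ _ e
  base-injective b₂ b₂ _ _ e = refl , +-cancelˡ-≡ (suc k + suc k) _ _ e
  base-injective b₀ b₁ a≤k _ e = contradiction e (no-overflow a≤k)
  base-injective b₀ b₂ a≤k _ e = contradiction (trans e (+-assoc (suc k) (suc k) _)) (no-overflow a≤k)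
  base-injective b₁ b₂ a≤k _ e = contradiction (+-cancelˡ-≡ (suc k) _ _ (trans e (+-assoc (suc k) (suc k) _))) (no-overflow a≤k)
  base-injective b₁ b₀ _ a′≤k e = contradiction (sym e) (no-overflow a′≤k)
  base-injective b₂ b₀ _ a′≤k e = contradiction (trans (sym e) (+-assoc (suc k) (suc k) _)) (no-overflow a′≤k)
  base-injective b₂ b₁ _ a′≤k e = contradiction (+-cancelˡ-≡ (suc k) _ _ (trans (sym e) (+-assoc (suc k) (suc k) _))) (no-overflow a′≤k)

  coords : Fin n → Block × ℕ
  coords j = let t , a , _ = blockView (toℕ j) (toℕ<n j) in t , a

  coords-bounded : ∀ j → proj₂ (coords j) ≤ k
  coords-bounded j = proj₁ (proj₂ (proj₂ (blockView (toℕ j) (toℕ<n j))))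

  position-coords : ∀ j → position (proj₁ (coords j)) (proj₂ (coords j)) ≡ j
  position-coords j = toℕ-injective (trans (toℕ-position t (coords-bounded j)) (proj₂ (proj₂ (proj₂ (blockView (toℕ j) (toℕ<n j))))))
    where
    t : Block
    t = proj₁ (coords j)

  coords-position : ∀ t {a} → a ≤ k → coords (position t a) ≡ (t , a)
  coords-position t {a} a≤k = cong₂ _,_ (proj₁ same) (proj₂ same)
    where
    j : Fin n
    j = position t a
    a′≤k : proj₂ (coords j) ≤ k
    a′≤k = coords-bounded j
    same : proj₁ (coords j) ≡ t × proj₂ (coords j) ≡ a
    same = base-injective (proj₁ (coords j)) t a′≤k a≤k
             (trans (sym (toℕ-position (proj₁ (coords j)) a′≤k)) (trans (cong toℕ (position-coords j)) (toℕ-position t a≤k)))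

  Code : Set
  Code = Kind × ℕ

  vert : Code → Vertex n
  vert ((U , t) , a) = u (position t a)
  vert ((V , t) , a) = v (position t a)

  code : Vertex n → Code
  code (u j) = (U , proj₁ (coords j)) , proj₂ (coords j)
  code (v j) = (V , proj₁ (coords j)) , proj₂ (coords j)

  code-bounded : ∀ y → proj₂ (code y) ≤ k
  code-bounded (u j) = coords-bounded j
  code-bounded (v j) = coords-bounded j

  code-vert : ∀ {c} → proj₂ c ≤ k → code (vert c) ≡ c
  code-vert {(U , t) , a} a≤k = cong (λ (t , a) → (U , t) , a) (coords-position t a≤k)
  code-vert {(V , t) , a} a≤k = cong (λ (t , a) → (V , t) , a) (coords-position t a≤k)

  vert-code : ∀ y → vert (code y) ≡ y
  vert-code (u j) = cong u (position-coords j)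
  vert-code (v j) = cong v (position-coords j)

  kind∈kinds : ∀ κ → κ ∈ kinds
  kind∈kinds (s , t) = ∈-cartesianProduct⁺ (side∈ s) (block∈ t)
    where
    side∈ : ∀ s → s ∈ U ∷ V ∷ []
    side∈ U = here refl
    side∈ V = there (here refl)
    block∈ : ∀ t → t ∈ b₀ ∷ b₁ ∷ b₂ ∷ []
    block∈ b₀ = here refl
    block∈ b₁ = there (here refl)
    block∈ b₂ = there (there (here refl))

  coding : Coding {n} {K} Code
  coding = record
    { vert         = vert
    ; code         = code
    ; codes        = cartesianProduct kinds (upTo (suc k))
    ; codes-unique = Unique.cartesianProduct⁺ kinds-unique (Unique.upTo⁺ (suc k))
    ; code∈codes   = λ y → ∈-cartesianProduct⁺ (kind∈kinds (proj₁ (code y))) (∈-upTo⁺ (s≤s (code-bounded y)))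
    ; vert-code    = vert-code
    ; code-vert    = λ {c} c∈ → code-vert (≤-pred (∈-upTo⁻ (proj₂ (∈-cartesianProduct⁻ kinds (upTo (suc k)) c∈))))
    }
    where
    kinds-unique : Unique kinds
    kinds-unique = Unique.cartesianProduct⁺ (((λ ()) All.∷ All.[]) ∷ All.[] ∷ [])
                     (((λ ()) All.∷ (λ ()) All.∷ All.[]) ∷ ((λ ()) All.∷ All.[]) ∷ All.[] ∷ [])

  shift : ∀ x m y → x + m ≡ y → idx x ⊕ m ≡ idx y
  shift x m y e = trans (idx-⊕ x m) (cong idx e)

  shift-wrap : ∀ x m y → x + m ≡ y + n → idx x ⊕ m ≡ idx y
  shift-wrap x m y e = trans (shift x m (y + n) e) (idx-+n y)

  rise-position : ∀ t a → position t a ⊕ 1 ≡ position t (suc a)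
  rise-position t a = shift (base t + a) 1 (base t + suc a) (trans (+-assoc (base t) a 1) (cong (base t +_) (+-comm a 1)))

  carry-position : ∀ t → position t k ⊕ 1 ≡ position (next t) 0
  carry-position b₀ = shift (0 + k) 1 (suc k + 0) (solve 1 (λ k → con 0 :+ k :+ con 1 := con 1 :+ k :+ con 0) refl k)
  carry-position b₁ = shift (suc k + k) 1 (suc k + suc k + 0)
    (solve 1 (λ k → con 1 :+ k :+ k :+ con 1 := con 1 :+ k :+ (con 1 :+ k) :+ con 0) refl k)
  carry-position b₂ = shift-wrap (suc k + suc k + k) 1 0
    (solve 1 (λ k → con 1 :+ k :+ (con 1 :+ k) :+ k :+ con 1 := con 0 :+ (con 1 :+ (con 3 :* k :+ con 2))) refl k)

  fall-position : ∀ t a → position t (suc a) ⊕ K ≡ position (next (next t)) a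
  fall-position b₀ a = shift (0 + suc a) K (suc k + suc k + a)
    (solve 2 (λ k a → con 0 :+ (con 1 :+ a) :+ (con 2 :* k :+ con 1) := con 1 :+ k :+ (con 1 :+ k) :+ a) refl k a)
  fall-position b₁ a = shift-wrap (suc k + suc a) K (0 + a)
    (solve 2 (λ k a → con 1 :+ k :+ (con 1 :+ a) :+ (con 2 :* k :+ con 1) := con 0 :+ a :+ (con 1 :+ (con 3 :* k :+ con 2))) refl k a)
  fall-position b₂ a = shift-wrap (suc k + suc k + suc a) K (suc k + a)
    (solve 2 (λ k a → con 1 :+ k :+ (con 1 :+ k) :+ (con 1 :+ a) :+ (con 2 :* k :+ con 1)
                     := con 1 :+ k :+ a :+ (con 1 :+ (con 3 :* k :+ con 2))) refl k a)

  borrow-position : ∀ t → position t 0 ⊕ K ≡ position (next t) k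
  borrow-position b₀ = shift (0 + 0) K (suc k + k) (solve 1 (λ k → con 0 :+ con 0 :+ (con 2 :* k :+ con 1) := con 1 :+ k :+ k) refl k)
  borrow-position b₁ = shift (suc k + 0) K (suc k + suc k + k)
    (solve 1 (λ k → con 1 :+ k :+ con 0 :+ (con 2 :* k :+ con 1) := con 1 :+ k :+ (con 1 :+ k) :+ k) refl k)
  borrow-position b₂ = shift-wrap (suc k + suc k + 0) K (0 + k)
    (solve 1 (λ k → con 1 :+ k :+ (con 1 :+ k) :+ con 0 :+ (con 2 :* k :+ con 1) := con 0 :+ k :+ (con 1 :+ (con 3 :* k :+ con 2))) refl k)

  data Step : Code → Code → Set where
    spoke  : ∀ t a → Step ((U , t) , a) ((V , t) , a)
    rise   : ∀ t {a} → a < k → Step ((U , t) , a) ((U , t) , suc a)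
    carry  : ∀ t → Step ((U , t) , k) ((U , next t) , 0)
    fall   : ∀ t {a} → a < k → Step ((V , t) , suc a) ((V , next (next t)) , a)
    borrow : ∀ t → Step ((V , t) , 0) ((V , next t) , k)

  step-edge : ∀ {c c′} → Step c c′ → Edge n K (vert c) (vert c′)
  step-edge (spoke t a)    = Edge.spoke (position t a)
  step-edge (rise t {a} _) = subst (Edge n K (u (position t a)) ∘ u) (rise-position t a) (outer (position t a))
  step-edge (carry t)      = subst (Edge n K (u (position t k)) ∘ u) (carry-position t) (outer (position t k))
  step-edge (fall t {a} _) = subst (Edge n K (v (position t (suc a))) ∘ v) (fall-position t a) (inner (position t (suc a)))
  step-edge (borrow t)     = subst (Edge n K (v (position t 0)) ∘ v) (borrow-position t) (inner (position t 0))

  step-code : ∀ {c c′} → proj₂ c ≤ k → proj₂ c′ ≤ k → Step c c′ → ∀ {y} → vert c′ ≡ y → Step (code (vert c)) (code y)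
  step-code c≤k c′≤k s refl = subst₂ Step (sym (code-vert c≤k)) (sym (code-vert c′≤k)) s

  outer-step : ∀ t {a} → a ≤ k → Step (code (u (position t a))) (code (u (position t a ⊕ 1)))
  outer-step t {a} a≤k with m≤n⇒m<n∨m≡n a≤k
  ... | inj₁ a<k  = step-code a≤k a<k (rise t a<k) (cong u (sym (rise-position t a)))
  ... | inj₂ refl = step-code a≤k z≤n (carry t) (cong u (sym (carry-position t)))

  inner-step : ∀ t {a} → a ≤ k → Step (code (v (position t a))) (code (v (position t a ⊕ K)))
  inner-step t {zero}  0≤k = step-code 0≤k ≤-refl (borrow t) (cong v (sym (borrow-position t)))
  inner-step t {suc a} a<k = step-code a<k (<⇒≤ a<k) (fall t a<k) (cong v (sym (fall-position t a)))

  edge-step : ∀ {x y} → Edge n K x y → Step (code x) (code y)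
  edge-step (outer j) = subst (λ j → Step (code (u j)) (code (u (j ⊕ 1)))) (position-coords j) (outer-step (proj₁ (coords j)) (coords-bounded j))
  edge-step (inner j) = subst (λ j → Step (code (v j)) (code (v (j ⊕ K)))) (position-coords j) (inner-step (proj₁ (coords j)) (coords-bounded j))
  edge-step (Edge.spoke j) = spoke (proj₁ (coords j)) (proj₂ (coords j))


-- The distance to offset a of kind κ is fromBelow κ a ⊓ fromAbove κ (k ∸ a): walks from u₀ reach
-- offset a either from smaller offsets or descending from offset k of the block.
fromBelow : Kind → ℕ → ℕ
fromBelow (U , b₀) a                 = a
fromBelow (U , b₁) zero              = 4
fromBelow (U , b₁) (suc a)           = 3 + a
fromBelow (U , b₂) zero              = 4
fromBelow (U , b₂) (suc zero)        = 5
fromBelow (U , b₂) (suc (suc a))     = 4 + a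
fromBelow (V , b₀) a                 = 1 + a
fromBelow (V , b₁) zero              = 3
fromBelow (V , b₁) (suc a)           = 2 + a
fromBelow (V , b₂) zero              = 3
fromBelow (V , b₂) (suc zero)        = 4
fromBelow (V , b₂) (suc (suc a))     = 3 + a

fromAbove : Kind → ℕ → ℕ
fromAbove (U , b₀) zero    = 5
fromAbove (U , b₀) (suc r) = 4 + r
fromAbove (U , b₁) r       = 3 + r
fromAbove (U , b₂) r       = 1 + r
fromAbove (V , b₀) zero    = 4
fromAbove (V , b₀) (suc r) = 3 + r
fromAbove (V , b₁) r       = 2 + r
fromAbove (V , b₂) r       = 2 + r

ramp₂ : ∀ {h} f → f + 2 ≤ 6 → h 0 ≤ 5 → h 1 ≤ 5 → (∀ a → h (2 + a) ≡ f + (2 + a)) → Ramp h 2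
ramp₂ f f+2≤6 h0≤5 h1≤5 linear = record { offset = f ; offset+start≤6 = f+2≤6 ; initial = initial ; linear = linear }
  where
  initial : ∀ a → a < 2 → _ ≤ 5
  initial 0 _ = h0≤5
  initial 1 _ = h1≤5
  initial (suc (suc _)) (s≤s (s≤s ()))

ramp₁ : ∀ {h} g → g + 1 ≤ 6 → h 0 ≤ 5 → (∀ r → h (1 + r) ≡ g + (1 + r)) → Ramp h 1
ramp₁ g g+1≤6 h0≤5 linear = record { offset = g ; offset+start≤6 = g+1≤6 ; initial = λ { 0 _ → h0≤5 ; (suc _) (s≤s ()) } ; linear = linear }

rampBelow : ∀ κ → Ramp (fromBelow κ) 2
rampBelow (U , b₀) = ramp₂ 0 ≤-eval ≤-eval ≤-eval λ _ → refl
rampBelow (U , b₁) = ramp₂ 2 ≤-eval ≤-eval ≤-eval λ _ → refl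
rampBelow (U , b₂) = ramp₂ 2 ≤-eval ≤-eval ≤-eval λ _ → refl
rampBelow (V , b₀) = ramp₂ 1 ≤-eval ≤-eval ≤-eval λ _ → refl
rampBelow (V , b₁) = ramp₂ 1 ≤-eval ≤-eval ≤-eval λ _ → refl
rampBelow (V , b₂) = ramp₂ 1 ≤-eval ≤-eval ≤-eval λ _ → refl

rampAbove : ∀ κ → Ramp (fromAbove κ) 1
rampAbove (U , b₀) = ramp₁ 3 ≤-eval ≤-eval λ _ → refl
rampAbove (U , b₁) = ramp₁ 3 ≤-eval ≤-eval λ _ → refl
rampAbove (U , b₂) = ramp₁ 1 ≤-eval ≤-eval λ _ → refl
rampAbove (V , b₀) = ramp₁ 2 ≤-eval ≤-eval λ _ → refl
rampAbove (V , b₁) = ramp₁ 2 ≤-eval ≤-eval λ _ → refl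
rampAbove (V , b₂) = ramp₁ 2 ≤-eval ≤-eval λ _ → refl

Close : ℕ → ℕ → Set
Close x y = x ≤ suc y × y ≤ suc x

close-suc : ∀ x → Close x (suc x)
close-suc x = m≤n+m x 2 , ≤-refl

close-pred : ∀ x → Close (suc x) x
close-pred x = ≤-refl , m≤n+m x 2

close-sym : ∀ {x y} → Close x y → Close y x
close-sym (x≤1+y , y≤1+x) = y≤1+x , x≤1+y

close-⊓ : ∀ {x y x′ y′} → Close x x′ → Close y y′ → Close (x ⊓ y) (x′ ⊓ y′)
close-⊓ (x≤ , x′≤) (y≤ , y′≤) = ⊓-mono-≤ x≤ y≤ , ⊓-mono-≤ x′≤ y′≤

close-spoke-below : ∀ t a → Close (fromBelow (U , t) a) (fromBelow (V , t) a)
close-spoke-below b₀ a             = close-suc a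
close-spoke-below b₁ zero          = close-pred 3
close-spoke-below b₁ (suc a)       = close-pred (2 + a)
close-spoke-below b₂ zero          = close-pred 3
close-spoke-below b₂ (suc zero)    = close-pred 4
close-spoke-below b₂ (suc (suc a)) = close-pred (3 + a)

close-spoke-above : ∀ t r → Close (fromAbove (U , t) r) (fromAbove (V , t) r)
close-spoke-above b₀ zero    = close-pred 4
close-spoke-above b₀ (suc r) = close-pred (3 + r)
close-spoke-above b₁ r       = close-pred (2 + r)
close-spoke-above b₂ r       = close-suc (1 + r)

close-rise-below : ∀ t a → Close (fromBelow (U , t) a) (fromBelow (U , t) (suc a))
close-rise-below b₀ a             = close-suc a
close-rise-below b₁ zero          = close-pred 3
close-rise-below b₁ (suc a)       = close-suc (3 + a)
close-rise-below b₂ zero          = close-suc 4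
close-rise-below b₂ (suc zero)    = close-pred 4
close-rise-below b₂ (suc (suc a)) = close-suc (4 + a)

close-rise-above : ∀ t r → Close (fromAbove (U , t) (suc r)) (fromAbove (U , t) r)
close-rise-above b₀ zero    = close-suc 4
close-rise-above b₀ (suc r) = close-pred (4 + r)
close-rise-above b₁ r       = close-pred (3 + r)
close-rise-above b₂ r       = close-pred (1 + r)

close-fall-below : ∀ t a → Close (fromBelow (V , t) (suc a)) (fromBelow (V , next (next t)) a)
close-fall-below b₀ zero          = close-suc 2
close-fall-below b₀ (suc zero)    = close-suc 3
close-fall-below b₀ (suc (suc a)) = close-pred (3 + a)
close-fall-below b₁ a             = close-pred (1 + a)
close-fall-below b₂ zero          = close-pred 3
close-fall-below b₂ (suc a)       = close-pred (2 + a)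

close-fall-above : ∀ t r → Close (fromAbove (V , t) r) (fromAbove (V , next (next t)) (suc r))
close-fall-above b₀ zero    = close-pred 3
close-fall-above b₀ (suc r) = close-suc (3 + r)
close-fall-above b₁ r       = close-suc (2 + r)
close-fall-above b₂ r       = close-suc (2 + r)

close-carry : ∀ t → Close (fromAbove (U , t) 0) (fromBelow (U , next t) 0)
close-carry b₀ = ≤-eval , ≤-eval
close-carry b₁ = ≤-eval , ≤-eval
close-carry b₂ = ≤-eval , ≤-eval

close-borrow : ∀ t → Close (fromBelow (V , t) 0) (fromAbove (V , next t) 0)
close-borrow b₀ = ≤-eval , ≤-eval
close-borrow b₁ = ≤-eval , ≤-eval
close-borrow b₂ = ≤-eval , ≤-eval

module Distance (k : ℕ) (6≤k : 6 ≤ k) where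
  open Coordinates k

  dist : Code → ℕ
  dist (κ , a) = fromBelow κ a ⊓ fromAbove κ (k ∸ a)

  dist-top : ∀ κ → dist (κ , k) ≡ fromAbove κ 0
  dist-top κ = trans (cong (λ r → fromBelow κ k ⊓ fromAbove κ r) (n∸n≡0 k))
    (m≥n⇒m⊓n≡n (≤-trans (Ramp.initial (rampAbove κ) 0 z<s) (<⇒≤ (large-argument⇒large-value (rampBelow κ) 6≤k))))

  dist-bottom : ∀ κ → dist (κ , 0) ≡ fromBelow κ 0
  dist-bottom κ = m≤n⇒m⊓n≡m (≤-trans (Ramp.initial (rampBelow κ) 0 z<s) (<⇒≤ (large-argument⇒large-value (rampAbove κ) 6≤k)))

  k∸a≡1+k∸[1+a] : ∀ {a} → a < k → k ∸ a ≡ suc (k ∸ suc a)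
  k∸a≡1+k∸[1+a] a<k = +-∸-assoc 1 a<k

  step-close : ∀ {c c′} → Step c c′ → Close (dist c) (dist c′)
  step-close (spoke t a)      = close-⊓ (close-spoke-below t a) (close-spoke-above t (k ∸ a))
  step-close (rise t {a} a<k) = close-⊓ (close-rise-below t a)
    (subst (λ r → Close (fromAbove (U , t) r) (fromAbove (U , t) (k ∸ suc a))) (sym (k∸a≡1+k∸[1+a] a<k)) (close-rise-above t (k ∸ suc a)))
  step-close (fall t {a} a<k) = close-⊓ (close-fall-below t a)
    (subst (λ r → Close (fromAbove (V , t) (k ∸ suc a)) (fromAbove (V , next (next t)) r)) (sym (k∸a≡1+k∸[1+a] a<k)) (close-fall-above t (k ∸ suc a)))
  step-close (carry t)  = subst₂ Close (sym (dist-top (U , t))) (sym (dist-bottom (U , next t))) (close-carry t)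
  step-close (borrow t) = subst₂ Close (sym (dist-bottom (V , t))) (sym (dist-top (V , next t))) (close-borrow t)

  Adjacent : Code → Code → Set
  Adjacent c′ c = Step c′ c ⊎ Step c c′

  adjacent-close : ∀ {c′ c} → Adjacent c′ c → Close (dist c′) (dist c)
  adjacent-close (inj₁ s) = step-close s
  adjacent-close (inj₂ s) = close-sym (step-close s)

  record Closer (c : Code) (b : ℕ) : Set where
    constructor closer
    field
      neighbour : Code
      bounded   : proj₂ neighbour ≤ k
      adjacent  : Adjacent neighbour c
      smaller   : dist neighbour < b

  closer-via-below : ∀ {c b} κ′ a′ → a′ ≤ k → Adjacent (κ′ , a′) c → fromBelow κ′ a′ < b → Closer c b
  closer-via-below κ′ a′ a′≤k adj lt = closer (κ′ , a′) a′≤k adj (≤-trans (s≤s (m⊓n≤m _ _)) lt)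

  pred-k∸ : ∀ {a r} → k ∸ a ≡ suc r → k ∸ suc a ≡ r
  pred-k∸ {a} e = trans (sym (pred[m∸n]≡m∸[1+n] k a)) (cong pred e)

  closer-via-above : ∀ {c b r} κ′ a′ → a′ ≤ k → Adjacent (κ′ , a′) c → k ∸ a′ ≡ r → fromAbove κ′ r < b → Closer c b
  closer-via-above κ′ a′ a′≤k adj refl lt = closer (κ′ , a′) a′≤k adj (≤-trans (s≤s (m⊓n≤n _ _)) lt)

  closer-via-top : ∀ {c b} κ′ → Adjacent (κ′ , k) c → fromAbove κ′ 0 < b → Closer c b
  closer-via-top κ′ adj lt = closer (κ′ , k) ≤-refl adj (subst (_< _) (sym (dist-top κ′)) lt)

  closer-via-bottom : ∀ {c b} κ′ → Adjacent (κ′ , 0) c → fromBelow κ′ 0 < b → Closer c b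
  closer-via-bottom κ′ adj lt = closer (κ′ , 0) z≤n adj (subst (_< _) (sym (dist-bottom κ′)) lt)

  closer-below : ∀ κ {a} → a ≤ k → 0 < fromBelow κ a → Closer (κ , a) (fromBelow κ a)
  closer-below (U , b₀) {suc a} a<k _ = closer-via-below (U , b₀) a (<⇒≤ a<k) (inj₁ (rise b₀ a<k)) ≤-refl
  closer-below (U , b₁) {a} a≤k _ = closer-via-below (V , b₁) a a≤k (inj₂ (spoke b₁ a)) (below-spoke a)
    where
    below-spoke : ∀ a → fromBelow (V , b₁) a < fromBelow (U , b₁) a
    below-spoke zero    = ≤-refl
    below-spoke (suc a) = ≤-refl
  closer-below (U , b₂) {a} a≤k _ = closer-via-below (V , b₂) a a≤k (inj₂ (spoke b₂ a)) (below-spoke a)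
    where
    below-spoke : ∀ a → fromBelow (V , b₂) a < fromBelow (U , b₂) a
    below-spoke zero          = ≤-refl
    below-spoke (suc zero)    = ≤-refl
    below-spoke (suc (suc a)) = ≤-refl
  closer-below (V , b₀) {a} a≤k _ = closer-via-below (U , b₀) a a≤k (inj₁ (spoke b₀ a)) ≤-refl
  closer-below (V , b₁) {zero} _ _ = closer-via-top (V , b₂) (inj₂ (borrow b₁)) ≤-eval
  closer-below (V , b₁) {suc a} a<k _ = closer-via-below (V , b₀) a (<⇒≤ a<k) (inj₂ (fall b₁ a<k)) ≤-refl
  closer-below (V , b₂) {zero} _ _ = closer-via-below (V , b₀) 1 1≤k (inj₁ (fall b₀ 1≤k)) ≤-eval
    where
    1≤k : 1 ≤ k
    1≤k = ≤-trans ≤-eval 6≤k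
  closer-below (V , b₂) {suc zero} 1≤k _ = closer-via-below (V , b₁) 0 z≤n (inj₂ (fall b₂ 1≤k)) ≤-eval
  closer-below (V , b₂) {suc (suc a)} a<k _ = closer-via-below (V , b₁) (suc a) (<⇒≤ a<k) (inj₂ (fall b₂ a<k)) ≤-refl

  closer-above-inner : ∀ κ {a r} → a < k → k ∸ a ≡ suc r → Closer (κ , a) (fromAbove κ (suc r))
  closer-above-inner (U , b₀) {a} a<k e = closer-via-above (V , b₀) a (<⇒≤ a<k) (inj₂ (spoke b₀ a)) e ≤-refl
  closer-above-inner (U , b₁) {a} a<k e = closer-via-above (V , b₁) a (<⇒≤ a<k) (inj₂ (spoke b₁ a)) e ≤-refl
  closer-above-inner (U , b₂) {a} a<k e = closer-via-above (U , b₂) (suc a) a<k (inj₂ (rise b₂ a<k)) (pred-k∸ e) ≤-refl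
  closer-above-inner (V , b₀) {a} a<k e = closer-via-above (V , b₁) (suc a) a<k (inj₁ (fall b₁ a<k)) (pred-k∸ e) ≤-refl
  closer-above-inner (V , b₁) {a} a<k e = closer-via-above (V , b₂) (suc a) a<k (inj₁ (fall b₂ a<k)) (pred-k∸ e) ≤-refl
  closer-above-inner (V , b₂) {a} a<k e = closer-via-above (U , b₂) a (<⇒≤ a<k) (inj₁ (spoke b₂ a)) e ≤-refl

  closer-above-top : ∀ κ → Closer (κ , k) (fromAbove κ 0)
  closer-above-top (U , b₀) = closer-via-bottom (U , b₁) (inj₂ (carry b₀)) ≤-eval
  closer-above-top (U , b₁) = closer-via-top (V , b₁) (inj₂ (spoke b₁ k)) ≤-eval
  closer-above-top (U , b₂) = closer-via-bottom (U , b₀) (inj₂ (carry b₂)) ≤-eval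
  closer-above-top (V , b₀) = closer-via-bottom (V , b₂) (inj₁ (borrow b₂)) ≤-eval
  closer-above-top (V , b₁) = closer-via-bottom (V , b₀) (inj₁ (borrow b₀)) ≤-eval
  closer-above-top (V , b₂) = closer-via-top (U , b₂) (inj₁ (spoke b₂ k)) ≤-eval

  closer-above : ∀ κ {a} → a ≤ k → Closer (κ , a) (fromAbove κ (k ∸ a))
  closer-above κ {a} a≤k with m≤n⇒m<n∨m≡n a≤k
  ... | inj₁ a<k  = subst (Closer (κ , a) ∘ fromAbove κ) (sym (k∸a≡1+k∸[1+a] a<k)) (closer-above-inner κ a<k (k∸a≡1+k∸[1+a] a<k))
  ... | inj₂ refl = subst (Closer (κ , k) ∘ fromAbove κ) (sym (n∸n≡0 k)) (closer-above-top κ)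

  closer-descent : ∀ {c m} → dist c ≡ suc m → Closer c (suc m) → ∃[ c′ ] (proj₂ c′ ≤ k × Adjacent c′ c × dist c′ ≡ m)
  closer-descent {c} {m} dc≡1+m (closer c′ c′≤k adj dc′<1+m) = c′ , c′≤k , adj , ≤-antisym (≤-pred dc′<1+m) m≤dc′
    where
    m≤dc′ : m ≤ dist c′
    m≤dc′ = ≤-pred (subst (_≤ suc (dist c′)) dc≡1+m (proj₂ (adjacent-close adj)))

  descent-code : ∀ {κ a m} → a ≤ k → dist (κ , a) ≡ suc m → ∃[ c′ ] (proj₂ c′ ≤ k × Adjacent c′ (κ , a) × dist c′ ≡ m)
  descent-code {κ} {a} a≤k dc≡1+m with ⊓-sel (fromBelow κ a) (fromAbove κ (k ∸ a))
  ... | inj₁ dc≡F = closer-descent dc≡1+m (subst (Closer (κ , a)) F≡1+m (closer-below κ a≤k (subst (0 <_) (sym F≡1+m) z<s)))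
    where
    F≡1+m : fromBelow κ a ≡ suc _
    F≡1+m = trans (sym dc≡F) dc≡1+m
  ... | inj₂ dc≡G = closer-descent dc≡1+m (subst (Closer (κ , a)) (trans (sym dc≡G) dc≡1+m) (closer-above κ a≤k))

  dist-zero : ∀ c → dist c ≡ 0 → c ≡ ((U , b₀) , 0)
  dist-zero (κ , a) dc≡0 with ⊓-sel (fromBelow κ a) (fromAbove κ (k ∸ a))
  ... | inj₁ dc≡F = fromBelow-zero κ a (trans (sym dc≡F) dc≡0)
    where
    fromBelow-zero : ∀ κ a → fromBelow κ a ≡ 0 → (κ , a) ≡ ((U , b₀) , 0)
    fromBelow-zero (U , b₀) zero          _ = refl
    fromBelow-zero (U , b₀) (suc a)       ()
    fromBelow-zero (U , b₁) zero          ()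
    fromBelow-zero (U , b₁) (suc a)       ()
    fromBelow-zero (U , b₂) zero          ()
    fromBelow-zero (U , b₂) (suc zero)    ()
    fromBelow-zero (U , b₂) (suc (suc a)) ()
    fromBelow-zero (V , b₀) a             ()
    fromBelow-zero (V , b₁) zero          ()
    fromBelow-zero (V , b₁) (suc a)       ()
    fromBelow-zero (V , b₂) zero          ()
    fromBelow-zero (V , b₂) (suc zero)    ()
    fromBelow-zero (V , b₂) (suc (suc a)) ()
  ... | inj₂ dc≡G = contradiction (trans (sym dc≡G) dc≡0) (fromAbove-nonzero κ (k ∸ a))
    where
    fromAbove-nonzero : ∀ κ r → fromAbove κ r ≢ 0
    fromAbove-nonzero (U , b₀) zero    ()
    fromAbove-nonzero (U , b₀) (suc r) ()
    fromAbove-nonzero (U , b₁) r       ()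
    fromAbove-nonzero (U , b₂) r       ()
    fromAbove-nonzero (V , b₀) zero    ()
    fromAbove-nonzero (V , b₀) (suc r) ()
    fromAbove-nonzero (V , b₁) r       ()
    fromAbove-nonzero (V , b₂) r       ()

  labelling : DistanceLabelling {n} {K} (u zero) (dist ∘ code)
  labelling = record
    { root-zero = refl
    ; zero-root = λ {y} dy≡0 → trans (sym (vert-code y)) (cong vert (dist-zero (code y) dy≡0))
    ; adj-≤     = λ { (inj₁ e) → proj₂ (step-close (edge-step e)) ; (inj₂ e) → proj₁ (step-close (edge-step e)) }
    ; descent   = descent
    }
    where
    descent : ∀ {y m} → dist (code y) ≡ suc m → ∃[ z ] (Adj n K z y × dist (code z) ≡ m)
    descent {y} dy≡1+m with descent-code (code-bounded y) dy≡1+m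
    ... | c′ , c′≤k , adj , dc′≡m = vert c′ , subst (Adj n K (vert c′)) (vert-code y) (Data.Sum.map step-edge step-edge adj)
                                           , trans (cong dist (code-vert {c′} c′≤k)) dc′≡m

module Spheres (k : ℕ) (11≤k : 11 ≤ k) where
  open Coordinates k
  open Distance k (≤-trans ≤-eval 11≤k)

  count : Kind → ℕ → ℕ
  count κ i = length (Profile.hits k (rampBelow κ) (rampAbove κ) i)

  sphere : ∀ i → SphereCard n K (u zero) i (sum (map (λ κ → count κ i) kinds))
  sphere i = subst (SphereCard n K (u zero) i) (length-filter-cartesianProduct (λ c → dist c ≟ i) kinds (upTo (suc k)))
                   (Coding.sphereCard coding dist (DistanceLabelling.isDist⇔ labelling) i)

  sphere-near : ∀ i → i ≤ 5 →
    SphereCard n K (u zero) i (sum (map (λ κ → length (earlyHits (fromBelow κ) i) + length (earlyHits (fromAbove κ) i)) kinds))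
  sphere-near i i≤5 = subst (SphereCard n K (u zero) i)
    (cong sum (map-cong (λ κ → Profile.length-hits-near k (rampBelow κ) (rampAbove κ) 11≤k i≤5) kinds)) (sphere i)

  sphere-far : ∀ {i m₃ m₅} → 6 ≤ i → Crossing (k + 3) i m₃ → Crossing (k + 5) i m₅ → SphereCard n K (u zero) i (5 * m₃ + m₅)
  sphere-far {i} {m₃} {m₅} 6≤i c₃ c₅ = subst (SphereCard n K (u zero) i) counts (sphere i)
    where
    far : ∀ κ {m} → Crossing (k + (Ramp.offset (rampBelow κ) + Ramp.offset (rampAbove κ))) i m → count κ i ≡ m
    far κ = Profile.length-hits-far k (rampBelow κ) (rampAbove κ) 6≤i
    counts : sum (map (λ κ → count κ i) kinds) ≡ 5 * m₃ + m₅
    counts = begin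
      count (U , b₀) i + (count (U , b₁) i + (count (U , b₂) i + (count (V , b₀) i + (count (V , b₁) i + (count (V , b₂) i + 0)))))
        ≡⟨ cong₂ _+_ (far (U , b₀) c₃) (cong₂ _+_ (far (U , b₁) c₅) (cong₂ _+_ (far (U , b₂) c₃)
             (cong₂ _+_ (far (V , b₀) c₃) (cong₂ _+_ (far (V , b₁) c₃) (cong₂ _+_ (far (V , b₂) c₃) refl))))) ⟩
      m₃ + (m₅ + (m₃ + (m₃ + (m₃ + (m₃ + 0)))))
        ≡⟨ solve 2 (λ x y → x :+ (y :+ (x :+ (x :+ (x :+ (x :+ con 0))))) := con 5 :* x :+ y) refl m₃ m₅ ⟩
      5 * m₃ + m₅ ∎
      where open ≡-Reasoning

⌈1+k/2⌉-double : ∀ k → ⌈ suc k /2⌉ + ⌈ suc k /2⌉ + k % 2 ≡ 2 + k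
⌈1+k/2⌉-double zero          = refl
⌈1+k/2⌉-double (suc zero)    = refl
⌈1+k/2⌉-double (suc (suc k)) = trans (cong (λ x → suc x + k % 2) (+-suc b b)) (cong (suc ∘ suc) (⌈1+k/2⌉-double k))
  where
  b : ℕ
  b = ⌈ suc k /2⌉

module LargeRadii (k : ℕ) (11≤k : 11 ≤ k) where
  open Coordinates k using (n; K)
  open Spheres k 11≤k

  b : ℕ
  b = ⌈ suc k /2⌉

  S : ℕ → ℕ → Set
  S i m = SphereCard n K (u zero) i m

  6≤b : 6 ≤ b
  6≤b = ⌈n/2⌉-mono (s≤s 11≤k)

  double-shift : ∀ x d → (x + d) + (x + d) ≡ (x + x) + (d + d)
  double-shift = solve 2 (λ x d → (x :+ d) :+ (x :+ d) := (x :+ x) :+ (d :+ d)) refl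

  below-by : ∀ {i d c} → i + i ≡ k + d → d < c → Crossing (k + c) i 2
  below-by {c = c} 2i≡k+d d<c = below (subst (_< k + c) (sym 2i≡k+d) (+-monoʳ-< k d<c))

  above-by : ∀ {i d c} → i + i ≡ k + d → c < d → Crossing (k + c) i 0
  above-by {c = c} 2i≡k+d c<d = above (subst (k + c <_) (sym 2i≡k+d) (+-monoʳ-< k c<d))

  sphere-middle : ∀ i → 6 ≤ i → i ≤ b → S i 12
  sphere-middle i 6≤i i≤b = sphere-far 6≤i (below (2i<k+ ≤-eval)) (below (2i<k+ ≤-eval))
    where
    2i<k+ : ∀ {c} → 3 ≤ c → i + i < k + c
    2i<k+ {c} 3≤c = begin-strict
      i + i               ≤⟨ +-mono-≤ i≤b i≤b ⟩
      b + b               ≤⟨ m≤m+n (b + b) (k % 2) ⟩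
      b + b + k % 2       ≡⟨ ⌈1+k/2⌉-double k ⟩
      2 + k               <⟨ +-monoˡ-< k 3≤c ⟩
      c + k               ≡⟨ +-comm c k ⟩
      k + c               ∎
      where open ≤-Reasoning

  module Parity {p : ℕ} (b+b≡p+k : b + b ≡ p + k) where

    double-b+ : ∀ d → (b + d) + (b + d) ≡ k + (p + (d + d))
    double-b+ d = trans (double-shift b d)
      (trans (cong (_+ (d + d)) b+b≡p+k) (solve 3 (λ p k x → (p :+ k) :+ x := k :+ (p :+ x)) refl p k (d + d)))

    empty-beyond : ∀ {d i} → 5 < p + (suc d + suc d) → b + d < i → S i 0
    empty-beyond {d} {i} 5<p+2d+2 b+d<i = sphere-far 6≤i (above (2i> ≤-eval)) (above (2i> ≤-refl))
      where
      6≤i : 6 ≤ i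
      6≤i = ≤-trans 6≤b (≤-trans (m≤m+n b d) (<⇒≤ b+d<i))
      b+[1+d]≤i : b + suc d ≤ i
      b+[1+d]≤i = subst (_≤ i) (sym (+-suc b d)) b+d<i
      2i> : ∀ {c} → c ≤ 5 → k + c < i + i
      2i> {c} c≤5 = begin-strict
        k + c                       <⟨ +-monoʳ-< k (≤-trans (s≤s c≤5) 5<p+2d+2) ⟩
        k + (p + (suc d + suc d))   ≡⟨ double-b+ (suc d) ⟨
        (b + suc d) + (b + suc d)   ≤⟨ +-mono-≤ b+[1+d]≤i b+[1+d]≤i ⟩
        i + i                       ∎
        where open ≤-Reasoning

  sphere-odd : k % 2 ≡ 1 → S (b + 1) 7 × S (b + 2) 1 × (∀ i → b + 2 < i → S i 0)
  sphere-odd k-odd = sphere-far (≤-trans 6≤b (m≤m+n b 1)) (at (double-b+ 1)) (below-by (double-b+ 1) ≤-eval)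
                   , sphere-far (≤-trans 6≤b (m≤m+n b 2)) (above-by (double-b+ 2) ≤-eval) (at (double-b+ 2))
                   , λ i → empty-beyond ≤-eval
    where
    b+b≡1+k : b + b ≡ 1 + k
    b+b≡1+k = +-cancelʳ-≡ 1 (b + b) (1 + k)
      (trans (subst (λ r → b + b + r ≡ 2 + k) k-odd (⌈1+k/2⌉-double k)) (+-comm 1 (1 + k)))
    open Parity b+b≡1+k

  sphere-even : k % 2 ≡ 0 → S (b + 1) 2 × (∀ i → b + 1 < i → S i 0)
  sphere-even k-even = sphere-far (≤-trans 6≤b (m≤m+n b 1)) (above-by (double-b+ 1) ≤-eval) (below-by (double-b+ 1) ≤-eval)
                     , λ i → empty-beyond ≤-eval
    where
    b+b≡2+k : b + b ≡ 2 + k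
    b+b≡2+k = trans (sym (+-identityʳ (b + b))) (subst (λ r → b + b + r ≡ 2 + k) k-even (⌈1+k/2⌉-double k))
    open Parity b+b≡2+k

corollary4p6 : (k : ℕ) → 13 ≤ k →
  let n = suc (3 * k + 2)
      b = ⌈ suc k /2⌉
      u₀ = u {n} zero
      S : ℕ → ℕ → Set
      S i m = SphereCard n (2 * k + 1) u₀ i m
  in (S 1 3 × S 2 6 × S 3 12 × S 4 16 × S 5 14)
     × (∀ i → 6 ≤ i → i ≤ b → S i 12)
     × (k % 2 ≡ 1 → S (b + 1) 7 × S (b + 2) 1 × (∀ i → b + 2 < i → S i 0))
     × (k % 2 ≡ 0 → S (b + 1) 2 × (∀ i → b + 1 < i → S i 0))
-- The count in sphere-near i evaluates to a numeral for each concrete i.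
corollary4p6 k 13≤k =
    (sphere-near 1 ≤-eval , sphere-near 2 ≤-eval , sphere-near 3 ≤-eval , sphere-near 4 ≤-eval , sphere-near 5 ≤-eval)
  , sphere-middle , sphere-odd , sphere-even
  where
  11≤k : 11 ≤ k
  11≤k = ≤-trans ≤-eval 13≤k
  open Spheres k 11≤k
  open LargeRadii k 11≤k
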